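{- Let $G=(V,E)$ be a directed unweighted graph with shortest path distances $d(\cdot,\cdot)$, let $v\in V$, and let $R(v)\subseteq V$ be any set of vertices. Define $$P(v)=\{y\in V \mid \forall t\in R(v),\ d(y,t)+2d(v,y)\le d(t,y)+2d(v,t)\}.$$ Then $P(v)$ induces a connected subgraph in the shortest path out-tree rooted at $v$.
   Context: In the paper, $R(v)$ is a subset of a randomly sampled vertex set $S\subseteq V$; the claim holds for any choice of $R(v)$. A shortest path out-tree rooted at $v$ is a tree of directed edges of $G$, rooted at $v$, containing all vertices reachable from $v$, in which the tree path from $v$ to each vertex $y$ is a shortest $v$-$y$ path in $G$. -}

module Defs where

open import Level using (Level; _⊔_) renaming (suc to lsuc)
open import Data.Nat using (ℕ; zero; suc; _+_; _≤_)
open import Data.Product using (Σ; _×_)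
open import Data.Unit using (⊤)
open import Data.Empty using (⊥)
open import Relation.Nullary using (¬_)
open import Relation.Binary.PropositionalEquality using (_≡_; _≢_)

-- Extended naturals: shortest-path distances may be infinite (unreachable).
data ℕ∞ : Set where
  fin : ℕ → ℕ∞
  ∞   : ℕ∞

infixl 6 _⊕_
_⊕_ : ℕ∞ → ℕ∞ → ℕ∞
fin a ⊕ fin b = fin (a + b)
fin _ ⊕ ∞     = ∞
∞     ⊕ _     = ∞

infix 4 _≼_
_≼_ : ℕ∞ → ℕ∞ → Set
fin a ≼ fin b = a ≤ b
_     ≼ ∞     = ⊤
∞     ≼ fin _ = ⊥

module _ {a e : Level} {V : Set a} (E : V → V → Set e) where

  data Walk : V → V → ℕ → Set (a ⊔ e) where
    nil  : ∀ {x} → Walk x x zero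
    cons : ∀ {x y z k} → E x y → Walk y z k → Walk x z (suc k)

  IsDist : V → V → ℕ∞ → Set (a ⊔ e)
  IsDist x y (fin k) = Walk x y k × (∀ m → Walk x y m → k ≤ m)
  IsDist x y ∞       = ∀ m → ¬ Walk x y m

  IsDistance : (V → V → ℕ∞) → Set (a ⊔ e)
  IsDistance d = ∀ x y → IsDist x y (d x y)

module _ {a e : Level} {V : Set a} (E : V → V → Set e) (d : V → V → ℕ∞) (v : V) where

  Reachable : V → Set
  Reachable y = d v y ≢ ∞

  record SPOutTree (ℓ : Level) : Set (a ⊔ e ⊔ lsuc ℓ) where
    field
      TEdge       : V → V → Set ℓ
      tedge⊆E     : ∀ {x y} → TEdge x y → E x y
      tedge-src   : ∀ {x y} → TEdge x y → Reachable x
      tedge-tgt   : ∀ {x y} → TEdge x y → Reachable y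
      parent      : ∀ y → Reachable y → y ≢ v → Σ V (λ x → TEdge x y)
      parent-uniq : ∀ {x x′ y} → TEdge x y → TEdge x′ y → x ≡ x′
      root-noin   : ∀ {x} → ¬ TEdge x v
      shortest    : ∀ {x y} → TEdge x y → d v y ≡ d v x ⊕ fin 1

  data ConnIn {ℓ s : Level} (T : SPOutTree ℓ) (S : V → Set s) : V → V → Set (a ⊔ ℓ ⊔ s) where
    here : ∀ {x} → S x → ConnIn T S x x
    fwd  : ∀ {x y z} → S x → SPOutTree.TEdge T x y → ConnIn T S y z → ConnIn T S x z
    bwd  : ∀ {x y z} → S x → SPOutTree.TEdge T y x → ConnIn T S y z → ConnIn T S x z

  InducesConnected : {ℓ s : Level} → SPOutTree ℓ → (V → Set s) → Set (a ⊔ ℓ ⊔ s)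
  InducesConnected T S = ∀ x y → Reachable x → Reachable y → S x → S y → ConnIn T S x y

P : {a r : Level} {V : Set a} → (V → V → ℕ∞) → V → (V → Set r) → V → Set (a ⊔ r)
P d v R y = ∀ t → R t → d y t ⊕ (d v y ⊕ d v y) ≼ d t y ⊕ (d v t ⊕ d v t)

{-# OPTIONS --safe #-}
-- A vertex y of P(v) at depth k+1 in the tree passes membership in P(v) to its tree
-- parent x: moving from y to x changes d(·,t) and d(t,·) by at most one each, while
-- the term 2 d(v,·) drops by exactly two.  So the tree path from any reachable vertex
-- of P(v) up to the root v stays inside P(v), and two such paths join any two vertices.
module Submission where

open import Defs
open import Level using (Level)
open import Data.Nat using (zero; suc; _+_; _≤_; s≤s)
open import Data.Nat.Properties
open import Data.Nat.Tactic.RingSolver using (solve-∀)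
open import Data.Product using (Σ; ∃; _,_; proj₁; proj₂)
open import Data.Unit using (tt)
open import Data.Empty using (⊥-elim)
open import Relation.Binary.PropositionalEquality

fin-injective : ∀ {m n} → fin m ≡ fin n → m ≡ n
fin-injective refl = refl

≼-∞ : ∀ x → x ≼ ∞
≼-∞ (fin _) = tt
≼-∞ ∞       = tt

⊕-fin1-cancel : ∀ δ {k} → δ ⊕ fin 1 ≡ fin (suc k) → δ ≡ fin k
⊕-fin1-cancel (fin j) eq = cong fin (suc-injective (trans (+-comm 1 j) (fin-injective eq)))

≢∞⇒fin : ∀ δ → δ ≢ ∞ → ∃ λ k → δ ≡ fin k
≢∞⇒fin (fin k) _   = k , refl
≢∞⇒fin ∞       δ≢∞ = ⊥-elim (δ≢∞ refl)

-- With a, b, c, d, w = d(x,t), d(y,t), d(t,y), d(t,x), d(v,t) for a tree edge x → y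
-- at depths k, k+1: the P-inequality at y yields the one at x.
P-step : ∀ k w {a b c d} → a ≤ suc b → c ≤ d + 1
       → b + (suc k + suc k) ≤ c + (w + w) → a + (k + k) ≤ d + (w + w)
P-step k w {a} {b} {c} {d} a≤ c≤ hyp = ≤-pred (begin
  suc (a + (k + k))       ≤⟨ s≤s (+-monoˡ-≤ (k + k) a≤) ⟩
  suc (suc b + (k + k))   ≡⟨ shift-suc b k ⟩
  b + (suc k + suc k)     ≤⟨ hyp ⟩
  c + (w + w)             ≤⟨ +-monoˡ-≤ (w + w) c≤ ⟩
  d + 1 + (w + w)         ≡⟨ cong (_+ (w + w)) (+-comm d 1) ⟩
  suc (d + (w + w))       ∎)
  where
  open ≤-Reasoning
  shift-suc : ∀ b k → suc (suc b + (k + k)) ≡ b + (suc k + suc k)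
  shift-suc = solve-∀

P-step∞ : ∀ k {a b c d w} → a ≼ fin 1 ⊕ b → c ≼ d ⊕ fin 1
        → b ⊕ (fin (suc k) ⊕ fin (suc k)) ≼ c ⊕ (w ⊕ w)
        → a ⊕ (fin k ⊕ fin k) ≼ d ⊕ (w ⊕ w)
P-step∞ k {a} {d = ∞}                     _  _  _   = ≼-∞ (a ⊕ _)
P-step∞ k {a} {d = fin _} {∞}             _  _  _   = ≼-∞ (a ⊕ _)
P-step∞ k {fin _} {fin _} {fin _} {fin _} {fin w} a≤ c≤ hyp = P-step k w a≤ c≤ hyp
P-step∞ k {fin _} {∞}     {fin _} {fin _} {fin _} _  _  ()
P-step∞ k {∞}     {fin _} {fin _} {fin _} {fin _} () _  _
P-step∞ k {_}     {_}     {∞}     {fin _} {fin _} _  () _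

module Distances {a e : Level} {V : Set a} (E : V → V → Set e) where

  _▷_ : ∀ {x y z k} → Walk E x y k → E y z → Walk E x z (k + 1)
  nil      ▷ yz = cons yz nil
  cons e w ▷ yz = cons e (w ▷ yz)

  walk-length-zero : ∀ {x y} → Walk E x y 0 → x ≡ y
  walk-length-zero nil = refl

  dist≼walk : ∀ {x y n} δ → IsDist E x y δ → Walk E x y n → δ ≼ fin n
  dist≼walk (fin k) (_ , minimal) w = minimal _ w
  dist≼walk ∞       unreachable   w = ⊥-elim (unreachable _ w)

  module _ {d : V → V → ℕ∞} (D : IsDistance E d) where

    dist-self : ∀ x → d x x ≡ fin 0
    dist-self x with d x x | D x x
    ... | fin zero    | _             = refl
    ... | fin (suc _) | (_ , minimal) with () ← minimal 0 nil
    ... | ∞           | unreachable   = ⊥-elim (unreachable 0 nil)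

    dist-zero⇒≡ : ∀ {x y} → d x y ≡ fin 0 → x ≡ y
    dist-zero⇒≡ {x} {y} eq with d x y | D x y
    dist-zero⇒≡ refl | fin 0 | (w , _) = walk-length-zero w

    dist-edgeˡ : ∀ {x y} t → E x y → d x t ≼ fin 1 ⊕ d y t
    dist-edgeˡ {x} {y} t xy with d y t | D y t
    ... | fin k | (w , _) = dist≼walk (d x t) (D x t) (cons xy w)
    ... | ∞     | _       = ≼-∞ (d x t)

    dist-edgeʳ : ∀ {x y} t → E x y → d t y ≼ d t x ⊕ fin 1
    dist-edgeʳ {x} {y} t xy with d t x | D t x
    ... | fin k | (w , _) = dist≼walk (d t y) (D t y) (w ▷ xy)
    ... | ∞     | _       = ≼-∞ (d t y)

module Connectivity {a e ℓ s : Level} {V : Set a} {E : V → V → Set e} {d : V → V → ℕ∞} {v : V}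
                    {T : SPOutTree E d v ℓ} {S : V → Set s} where

  ConnIn-source : ∀ {x y} → ConnIn E d v T S x y → S x
  ConnIn-source (here sx)    = sx
  ConnIn-source (fwd sx _ _) = sx
  ConnIn-source (bwd sx _ _) = sx

  ConnIn-trans : ∀ {x y z} → ConnIn E d v T S x y → ConnIn E d v T S y z → ConnIn E d v T S x z
  ConnIn-trans (here _)     q = q
  ConnIn-trans (fwd sx t p) q = fwd sx t (ConnIn-trans p q)
  ConnIn-trans (bwd sx t p) q = bwd sx t (ConnIn-trans p q)

  ConnIn-sym : ∀ {x y} → ConnIn E d v T S x y → ConnIn E d v T S y x
  ConnIn-sym (here sx)    = here sx
  ConnIn-sym (fwd sx t p) = ConnIn-trans (ConnIn-sym p) (bwd (ConnIn-source p) t (here sx))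
  ConnIn-sym (bwd sx t p) = ConnIn-trans (ConnIn-sym p) (fwd (ConnIn-source p) t (here sx))

module _ {a e r ℓ : Level} {V : Set a} (E : V → V → Set e) (d : V → V → ℕ∞)
         (D : IsDistance E d) (v : V) (R : V → Set r) (T : SPOutTree E d v ℓ) where

  open SPOutTree T
  open Distances E

  P-parent-closed : ∀ {x y} k → d v y ≡ fin (suc k) → d v x ≡ fin k
                  → TEdge x y → P d v R y → P d v R x
  P-parent-closed {y = y} k dy dx xy Py t Rt rewrite dx =
    P-step∞ k (dist-edgeˡ D t (tedge⊆E xy)) (dist-edgeʳ D t (tedge⊆E xy))
      (subst (λ δ → d y t ⊕ (δ ⊕ δ) ≼ d t y ⊕ (d v t ⊕ d v t)) dy (Py t Rt))

  P-joined-to-root : ∀ k y → d v y ≡ fin k → P d v R y → ConnIn E d v T (P d v R) y v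
  P-joined-to-root zero    y dy Py with refl ← dist-zero⇒≡ D dy = here Py
  P-joined-to-root (suc k) y dy Py = bwd Py xy (P-joined-to-root k x dx (P-parent-closed k dy dx xy Py))
    where
    y≢v : y ≢ v
    y≢v refl with () ← trans (sym dy) (dist-self D v)
    y-reachable : Reachable E d v y
    y-reachable dy≡∞ with () ← trans (sym dy) dy≡∞
    parent-of-y : Σ V (λ x → TEdge x y)
    parent-of-y = parent y y-reachable y≢v
    x : V
    x = proj₁ parent-of-y
    xy : TEdge x y
    xy = proj₂ parent-of-y
    dx : d v x ≡ fin k
    dx = ⊕-fin1-cancel (d v x) (trans (sym (shortest xy)) dy)

lemma9 : {a e r ℓ : Level} {V : Set a} (E : V → V → Set e) (d : V → V → ℕ∞)
         → IsDistance E d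
         → (v : V) (R : V → Set r) (T : SPOutTree E d v ℓ)
         → InducesConnected E d v T (P d v R)
lemma9 E d D v R T x y x-reachable y-reachable Px Py =
  ConnIn-trans (joined x x-reachable Px) (ConnIn-sym (joined y y-reachable Py))
  where
  open Connectivity
  joined : ∀ z → Reachable E d v z → P d v R z → ConnIn E d v T (P d v R) z v
  joined z z-reachable Pz with k , dz ← ≢∞⇒fin (d v z) z-reachable =
    P-joined-to-root E d D v R T k z dz Pz
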